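{- Let $(\mathbb{X},\dagger)$ be a dagger category with finite $\dagger$-biproducts and negatives. A map $f: A\to B$ has a generalized singular value decomposition if and only if $f$ is Moore-Penrose split and both $f$ and $f^\dagger$ have $\dagger$-kernels.
   Context: Composition is in diagrammatic order. A dagger category is a category with an identity-on-objects contravariant involutive functor $\dagger$. Isometry: $s: A\to B$ with $ss^\dagger = 1_A$; unitary: $u$ with $uu^\dagger = 1$, $u^\dagger u = 1$. Finite $\dagger$-biproducts: finite biproducts $\oplus$ (with zero object and zero maps $0$) whose projections $\pi_j$ and injections $\iota_j$ satisfy $\pi_j^\dagger = \iota_j$. Negatives: each hom-set, a commutative monoid under the biproduct-induced addition, is an abelian group. A $\dagger$-kernel of $g: A\to B$ is a kernel $k: \mathsf{ker}(g)\to A$ ($kg = 0$, universal) which is an isometry. A Moore-Penrose inverse of $f: A\to B$ is $f^\circ: B\to A$ with $ff^\circ f = f$, $f^\circ f f^\circ = f^\circ$, $(ff^\circ)^\dagger = ff^\circ$, $(f^\circ f)^\dagger = f^\circ f$. A $\dagger$-idempotent $e$ $\dagger$-splits if $e = rr^\dagger$ with $r^\dagger r = 1$; $f$ is Moore-Penrose split if it has a Moore-Penrose inverse $f^\circ$ and $ff^\circ$, $f^\circ f$ both $\dagger$-split. A generalized singular value decomposition of $f$ is a triple $(u: A\to X\oplus Z, d: X\to Y, v: Y\oplus W\to B)$ with $u, v$ unitary, $d$ an isomorphism and $f = u(d\oplus 0)v$. -}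

module Defs where

open import Level using (Level; _⊔_; suc)
open import Data.Product using (Σ; Σ-syntax; _×_; _,_)
open import Relation.Binary.Structures using (IsEquivalence)

-- Dagger categories, with setoid-valued hom-sets and composition written
-- in DIAGRAMMATIC order:  f ⨾ g  means "first f, then g".
record DaggerCategory (o ℓ e : Level) : Set (suc (o ⊔ ℓ ⊔ e)) where
  infixr 9 _⨾_
  infix  4 _≈_
  infix  10 _†
  field
    Obj   : Set o
    Hom   : Obj → Obj → Set ℓ
    _≈_   : ∀ {A B} → Hom A B → Hom A B → Set e
    ≈-equiv : ∀ {A B} → IsEquivalence (_≈_ {A} {B})
    id    : ∀ {A} → Hom A A
    _⨾_   : ∀ {A B C} → Hom A B → Hom B C → Hom A C
    ⨾-cong : ∀ {A B C} {f f' : Hom A B} {g g' : Hom B C} →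
             f ≈ f' → g ≈ g' → (f ⨾ g) ≈ (f' ⨾ g')
    identityˡ : ∀ {A B} (f : Hom A B) → (id ⨾ f) ≈ f
    identityʳ : ∀ {A B} (f : Hom A B) → (f ⨾ id) ≈ f
    assoc : ∀ {A B C D} (f : Hom A B) (g : Hom B C) (h : Hom C D) →
            ((f ⨾ g) ⨾ h) ≈ (f ⨾ (g ⨾ h))
    _†    : ∀ {A B} → Hom A B → Hom B A
    †-cong : ∀ {A B} {f g : Hom A B} → f ≈ g → (f †) ≈ (g †)
    †-id  : ∀ {A} → (id {A} †) ≈ id
    †-⨾   : ∀ {A B C} (f : Hom A B) (g : Hom B C) → ((f ⨾ g) †) ≈ (g † ⨾ f †)
    †-invol : ∀ {A B} (f : Hom A B) → ((f †) †) ≈ f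

module _ {o ℓ e : Level} (𝕏 : DaggerCategory o ℓ e) where
  open DaggerCategory 𝕏

  IsIsometry : ∀ {A B} → Hom A B → Set e
  IsIsometry s = (s ⨾ s †) ≈ id

  IsUnitary : ∀ {A B} → Hom A B → Set e
  IsUnitary u = ((u ⨾ u †) ≈ id) × ((u † ⨾ u) ≈ id)

  IsIso : ∀ {A B} → Hom A B → Set (ℓ ⊔ e)
  IsIso {A} {B} d = Σ[ d⁻¹ ∈ Hom B A ] (((d ⨾ d⁻¹) ≈ id) × ((d⁻¹ ⨾ d) ≈ id))

  record IsZeroObject (Z : Obj) : Set (o ⊔ ℓ ⊔ e) where
    field
      ! : ∀ A → Hom A Z
      !-unique : ∀ {A} (h : Hom A Z) → h ≈ ! A
      ¡ : ∀ A → Hom Z A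
      ¡-unique : ∀ {A} (h : Hom Z A) → h ≈ ¡ A

  record IsBiproduct (zero : ∀ {X Y} → Hom X Y) {A B : Obj} (P : Obj)
                     (π₁ : Hom P A) (π₂ : Hom P B)
                     (ι₁ : Hom A P) (ι₂ : Hom B P) : Set (o ⊔ ℓ ⊔ e) where
    field
      ⟨_,_⟩ : ∀ {C} → Hom C A → Hom C B → Hom C P
      ⟨⟩-π₁ : ∀ {C} (f : Hom C A) (g : Hom C B) → (⟨ f , g ⟩ ⨾ π₁) ≈ f
      ⟨⟩-π₂ : ∀ {C} (f : Hom C A) (g : Hom C B) → (⟨ f , g ⟩ ⨾ π₂) ≈ g
      ⟨⟩-unique : ∀ {C} {f : Hom C A} {g : Hom C B} (h : Hom C P) →
                  (h ⨾ π₁) ≈ f → (h ⨾ π₂) ≈ g → h ≈ ⟨ f , g ⟩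
      [_,_] : ∀ {C} → Hom A C → Hom B C → Hom P C
      ι₁-[] : ∀ {C} (f : Hom A C) (g : Hom B C) → (ι₁ ⨾ [ f , g ]) ≈ f
      ι₂-[] : ∀ {C} (f : Hom A C) (g : Hom B C) → (ι₂ ⨾ [ f , g ]) ≈ g
      []-unique : ∀ {C} {f : Hom A C} {g : Hom B C} (h : Hom P C) →
                  (ι₁ ⨾ h) ≈ f → (ι₂ ⨾ h) ≈ g → h ≈ [ f , g ]
      ι₁π₁ : (ι₁ ⨾ π₁) ≈ id
      ι₂π₂ : (ι₂ ⨾ π₂) ≈ id
      ι₁π₂ : (ι₁ ⨾ π₂) ≈ zero
      ι₂π₁ : (ι₂ ⨾ π₁) ≈ zero

record DaggerBiproducts {o ℓ e : Level} (𝕏 : DaggerCategory o ℓ e)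
       : Set (o ⊔ ℓ ⊔ e) where
  open DaggerCategory 𝕏
  infixr 6 _⊕_
  field
    𝟎 : Obj
    𝟎-isZero : IsZeroObject 𝕏 𝟎
  open IsZeroObject 𝟎-isZero
  0m : ∀ {A B} → Hom A B
  0m {A} {B} = ! A ⨾ ¡ B
  field
    _⊕_ : Obj → Obj → Obj
    π₁ : ∀ {A B} → Hom (A ⊕ B) A
    π₂ : ∀ {A B} → Hom (A ⊕ B) B
    ι₁ : ∀ {A B} → Hom A (A ⊕ B)
    ι₂ : ∀ {A B} → Hom B (A ⊕ B)
    isBiproduct : ∀ {A B} → IsBiproduct 𝕏 0m (A ⊕ B) (π₁ {A} {B}) π₂ ι₁ ι₂
    π₁†≈ι₁ : ∀ {A B} → (π₁ {A} {B} †) ≈ ι₁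
    π₂†≈ι₂ : ∀ {A B} → (π₂ {A} {B} †) ≈ ι₂
  module _ {A B : Obj} where
    open IsBiproduct (isBiproduct {A} {B}) public using (⟨_,_⟩; [_,_])
  infixl 6 _+_
  _+_ : ∀ {A B} → Hom A B → Hom A B → Hom A B
  f + g = ⟨ f , g ⟩ ⨾ [ id , id ]
  _⊕₁_ : ∀ {A B C D} → Hom A C → Hom B D → Hom (A ⊕ B) (C ⊕ D)
  f ⊕₁ g = ⟨ π₁ ⨾ f , π₂ ⨾ g ⟩

record HasNegatives {o ℓ e : Level} {𝕏 : DaggerCategory o ℓ e}
       (bp : DaggerBiproducts 𝕏) : Set (o ⊔ ℓ ⊔ e) where
  open DaggerCategory 𝕏
  open DaggerBiproducts bp
  field
    negatives : ∀ {A B} (f : Hom A B) → Σ[ g ∈ Hom A B ] ((f + g) ≈ 0m)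

module _ {o ℓ e : Level} {𝕏 : DaggerCategory o ℓ e}
         (bp : DaggerBiproducts 𝕏) where
  open DaggerCategory 𝕏
  open DaggerBiproducts bp

  IsKernel : ∀ {K A B} → Hom K A → Hom A B → Set (o ⊔ ℓ ⊔ e)
  IsKernel {K} {A} {B} k g =
    ((k ⨾ g) ≈ 0m) ×
    (∀ {C} (h : Hom C A) → (h ⨾ g) ≈ 0m →
       Σ[ m ∈ Hom C K ] ((m ⨾ k) ≈ h ×
         (∀ (m' : Hom C K) → (m' ⨾ k) ≈ h → m' ≈ m)))

  HasDaggerKernel : ∀ {A B} → Hom A B → Set (o ⊔ ℓ ⊔ e)
  HasDaggerKernel {A} {B} g =
    Σ[ K ∈ Obj ] Σ[ k ∈ Hom K A ] (IsKernel k g × IsIsometry 𝕏 k)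

  IsMoorePenroseInverse : ∀ {A B} → Hom A B → Hom B A → Set e
  IsMoorePenroseInverse f f° =
    ((f ⨾ f° ⨾ f) ≈ f) × ((f° ⨾ f ⨾ f°) ≈ f°) ×
    (((f ⨾ f°) †) ≈ (f ⨾ f°)) × (((f° ⨾ f) †) ≈ (f° ⨾ f))

  DaggerSplits : ∀ {A} → Hom A A → Set (o ⊔ ℓ ⊔ e)
  DaggerSplits {A} ε =
    Σ[ C ∈ Obj ] Σ[ r ∈ Hom A C ] ((ε ≈ (r ⨾ r †)) × ((r † ⨾ r) ≈ id))

  IsMoorePenroseSplit : ∀ {A B} → Hom A B → Set (o ⊔ ℓ ⊔ e)
  IsMoorePenroseSplit {A} {B} f =
    Σ[ f° ∈ Hom B A ] (IsMoorePenroseInverse f f° ×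
      DaggerSplits (f ⨾ f°) × DaggerSplits (f° ⨾ f))

  HasGSVD : ∀ {A B} → Hom A B → Set (o ⊔ ℓ ⊔ e)
  HasGSVD {A} {B} f =
    Σ[ X ∈ Obj ] Σ[ Z ∈ Obj ] Σ[ Y ∈ Obj ] Σ[ W ∈ Obj ]
    Σ[ u ∈ Hom A (X ⊕ Z) ] Σ[ d ∈ Hom X Y ] Σ[ v ∈ Hom (Y ⊕ W) B ]
      (IsUnitary 𝕏 u × IsIso 𝕏 d × IsUnitary 𝕏 v ×
       (f ≈ (u ⨾ (d ⊕₁ (0m {Z} {W})) ⨾ v)))

{-# OPTIONS --safe #-}

-- A generalized SVD f = u (d ⊕ 0) v exhibits f as a coisometry u π₁, an
-- isomorphism d and an isometry ι₁ v in sequence, which directly yields a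
-- Moore-Penrose inverse with †-split projections, and the kernels ι₂ u† of f
-- and ι₂ v of f†.  Conversely, if f f° = r r† and f° f = s s†, then
-- u = ⟨ r , k† ⟩ and v = ⟨ s , k'† ⟩† (k, k' the †-kernels of f and f†) are
-- unitary and d = r† f s is invertible.  Unitarity of u amounts to
-- f f° + k† k = 1: with negatives, 1 - f f° is a self-adjoint map killed by
-- f and fixed by k, so it is the projection k† k onto the kernel.

module Submission where

open import Defs
open import Level using (Level)
open import Data.Product using (_×_; _,_; Σ-syntax; proj₁; proj₂)
open import Function.Bundles using (_⇔_; mk⇔)
open import Relation.Binary.Structures using (IsEquivalence)
open import Relation.Binary.Bundles using (Setoid)
import Relation.Binary.Reasoning.Setoid as SetoidReasoning

module DaggerProperties {o ℓ e : Level} (𝕏 : DaggerCategory o ℓ e) where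
  open DaggerCategory 𝕏

  hom-setoid : Obj → Obj → Setoid ℓ e
  hom-setoid A B = record { Carrier = Hom A B ; _≈_ = _≈_ ; isEquivalence = ≈-equiv }

  module ≈ {A B : Obj} = IsEquivalence (≈-equiv {A} {B})

  module _ {A B : Obj} where
    open SetoidReasoning (hom-setoid A B) public

  SelfAdjoint : ∀ {A} → Hom A A → Set e
  SelfAdjoint p = (p †) ≈ p

  private
    variable
      A B C D E : Obj

  infixr 4 _⟩⨾⟨_ refl⟩⨾⟨_
  infixl 5 _⟩⨾⟨refl

  _⟩⨾⟨_ : {f f' : Hom A B} {g g' : Hom B C} → f ≈ f' → g ≈ g' → (f ⨾ g) ≈ (f' ⨾ g')
  _⟩⨾⟨_ = ⨾-cong

  refl⟩⨾⟨_ : {f : Hom A B} {g g' : Hom B C} → g ≈ g' → (f ⨾ g) ≈ (f ⨾ g')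
  refl⟩⨾⟨ p = ⨾-cong ≈.refl p

  _⟩⨾⟨refl : {f f' : Hom A B} {g : Hom B C} → f ≈ f' → (f ⨾ g) ≈ (f' ⨾ g)
  p ⟩⨾⟨refl = ⨾-cong p ≈.refl

  assoc′ : {f : Hom A B} {g : Hom B C} {h : Hom C D} → ((f ⨾ g) ⨾ h) ≈ (f ⨾ g ⨾ h)
  assoc′ = assoc _ _ _

  sym-assoc : {f : Hom A B} {g : Hom B C} {h : Hom C D} → (f ⨾ g ⨾ h) ≈ ((f ⨾ g) ⨾ h)
  sym-assoc = ≈.sym assoc′

  assoc² : {x : Hom A B} {y : Hom B C} {z : Hom C D} {w : Hom D E} →
           ((x ⨾ y ⨾ z) ⨾ w) ≈ (x ⨾ y ⨾ z ⨾ w)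
  assoc² = ≈.trans assoc′ (refl⟩⨾⟨ assoc′)

  pullˡ : {a : Hom A B} {b : Hom B C} {c : Hom A C} {x : Hom C D} →
          (a ⨾ b) ≈ c → (a ⨾ b ⨾ x) ≈ (c ⨾ x)
  pullˡ p = ≈.trans sym-assoc (p ⟩⨾⟨refl)

  pullʳ : {a : Hom A B} {b : Hom B C} {c : Hom C D} {d : Hom B D} →
          (b ⨾ c) ≈ d → ((a ⨾ b) ⨾ c) ≈ (a ⨾ d)
  pullʳ p = ≈.trans assoc′ (refl⟩⨾⟨ p)

  cancelˡ : {a : Hom A B} {b : Hom B A} {x : Hom A C} → (a ⨾ b) ≈ id → (a ⨾ b ⨾ x) ≈ x
  cancelˡ p = ≈.trans (pullˡ p) (identityˡ _)

  cancelʳ : {a : Hom A B} {b : Hom B A} {x : Hom C A} → (a ⨾ b) ≈ id → ((x ⨾ a) ⨾ b) ≈ x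
  cancelʳ p = ≈.trans (pullʳ p) (identityʳ _)

  †† : {f : Hom A B} → ((f †) †) ≈ f
  †† = †-invol _

  †⨾ : {f : Hom A B} {g : Hom B C} → ((f ⨾ g) †) ≈ (g † ⨾ f †)
  †⨾ = †-⨾ _ _

  †⨾⨾ : {x : Hom A B} {y : Hom B C} {z : Hom C D} → ((x ⨾ y ⨾ z) †) ≈ (z † ⨾ y † ⨾ x †)
  †⨾⨾ = ≈.trans †⨾ (≈.trans (†⨾ ⟩⨾⟨refl) assoc′)

  selfAdjoint-resp-≈ : {p q : Hom A A} → p ≈ q → SelfAdjoint q → SelfAdjoint p
  selfAdjoint-resp-≈ p≈q q† = ≈.trans (†-cong p≈q) (≈.trans q† (≈.sym p≈q))

  selfAdjoint-† : {p : Hom A A} → SelfAdjoint p → SelfAdjoint (p †)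
  selfAdjoint-† p† = ≈.trans †† (≈.sym p†)

  ⨾†-selfAdjoint : {r : Hom A B} → SelfAdjoint (r ⨾ r †)
  ⨾†-selfAdjoint = ≈.trans †⨾ (†† ⟩⨾⟨refl)

  isometry-⨾ : {s : Hom A B} {t : Hom B C} →
               IsIsometry 𝕏 s → IsIsometry 𝕏 t → IsIsometry 𝕏 (s ⨾ t)
  isometry-⨾ ss† tt† = ≈.trans (refl⟩⨾⟨ †⨾) (≈.trans assoc′ (≈.trans (refl⟩⨾⟨ cancelˡ tt†) ss†))

  unitary-† : {u : Hom A B} → IsUnitary 𝕏 u → IsUnitary 𝕏 (u †)
  unitary-† (uu† , u†u) = ≈.trans (refl⟩⨾⟨ ††) u†u , ≈.trans (†† ⟩⨾⟨refl) uu†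

  iso-† : {d : Hom A B} → IsIso 𝕏 d → IsIso 𝕏 (d †)
  iso-† (d⁻¹ , dd⁻¹ , d⁻¹d) =
    d⁻¹ † , ≈.trans (≈.sym †⨾) (≈.trans (†-cong d⁻¹d) †-id)
          , ≈.trans (≈.sym †⨾) (≈.trans (†-cong dd⁻¹) †-id)

module BiproductProperties {o ℓ e : Level} {𝕏 : DaggerCategory o ℓ e}
                           (bp : DaggerBiproducts 𝕏) where
  open DaggerCategory 𝕏
  open DaggerProperties 𝕏
  open DaggerBiproducts bp
  open IsZeroObject 𝟎-isZero
  module BP {A B : Obj} = IsBiproduct (isBiproduct {A} {B})

  private
    variable
      A B C D X Y Z W : Obj

  zeroˡ : {f : Hom B C} → (0m {A} {B} ⨾ f) ≈ 0m
  zeroˡ = pullʳ (¡-unique _)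

  zeroʳ : {f : Hom A B} → (f ⨾ 0m {B} {C}) ≈ 0m
  zeroʳ = ≈.trans sym-assoc (!-unique _ ⟩⨾⟨refl)

  0m-† : ((0m {A} {B}) †) ≈ 0m
  0m-† = ≈.trans †⨾ (!-unique _ ⟩⨾⟨ ¡-unique _)

  ι₁-† : ((ι₁ {A} {B}) †) ≈ π₁
  ι₁-† = ≈.trans (†-cong (≈.sym π₁†≈ι₁)) ††

  ι₂-† : ((ι₂ {A} {B}) †) ≈ π₂
  ι₂-† = ≈.trans (†-cong (≈.sym π₂†≈ι₂)) ††

  ι₂-isometry : IsIsometry 𝕏 (ι₂ {A} {B})
  ι₂-isometry = ≈.trans (refl⟩⨾⟨ ι₂-†) BP.ι₂π₂

  ⟨⟩-cong : {f f' : Hom C A} {g g' : Hom C B} → f ≈ f' → g ≈ g' → ⟨ f , g ⟩ ≈ ⟨ f' , g' ⟩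
  ⟨⟩-cong p q = BP.⟨⟩-unique _ (≈.trans (BP.⟨⟩-π₁ _ _) p) (≈.trans (BP.⟨⟩-π₂ _ _) q)

  []-cong : {f f' : Hom A C} {g g' : Hom B C} → f ≈ f' → g ≈ g' → [ f , g ] ≈ [ f' , g' ]
  []-cong p q = BP.[]-unique _ (≈.trans (BP.ι₁-[] _ _) p) (≈.trans (BP.ι₂-[] _ _) q)

  ⨾⟨⟩ : {x : Hom D C} {f : Hom C A} {g : Hom C B} → (x ⨾ ⟨ f , g ⟩) ≈ ⟨ x ⨾ f , x ⨾ g ⟩
  ⨾⟨⟩ = BP.⟨⟩-unique _ (pullʳ (BP.⟨⟩-π₁ _ _)) (pullʳ (BP.⟨⟩-π₂ _ _))

  []⨾ : {x : Hom C D} {f : Hom A C} {g : Hom B C} → ([ f , g ] ⨾ x) ≈ [ f ⨾ x , g ⨾ x ]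
  []⨾ = BP.[]-unique _ (pullˡ (BP.ι₁-[] _ _)) (pullˡ (BP.ι₂-[] _ _))

  ⟨⟩-† : {f : Hom C A} {g : Hom C B} → (⟨ f , g ⟩ †) ≈ [ f † , g † ]
  ⟨⟩-† = BP.[]-unique _
    (≈.trans (≈.sym π₁†≈ι₁ ⟩⨾⟨refl) (≈.trans (≈.sym †⨾) (†-cong (BP.⟨⟩-π₁ _ _))))
    (≈.trans (≈.sym π₂†≈ι₂ ⟩⨾⟨refl) (≈.trans (≈.sym †⨾) (†-cong (BP.⟨⟩-π₂ _ _))))

  []-† : {f : Hom A C} {g : Hom B C} → ([ f , g ] †) ≈ ⟨ f † , g † ⟩
  []-† {f = f} {g} = begin
    [ f , g ] †            ≈⟨ †-cong ([]-cong †† ††) ⟨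
    [ f † † , g † † ] †    ≈⟨ †-cong ⟨⟩-† ⟨
    ⟨ f † , g † ⟩ † †      ≈⟨ †† ⟩
    ⟨ f † , g † ⟩          ∎

  ⟨-,0⟩≈⨾ι₁ : {f : Hom C A} → ⟨ f , 0m {C} {B} ⟩ ≈ (f ⨾ ι₁)
  ⟨-,0⟩≈⨾ι₁ = ≈.sym (BP.⟨⟩-unique _ (≈.trans (pullʳ BP.ι₁π₁) (identityʳ _))
                                     (≈.trans (pullʳ BP.ι₁π₂) zeroʳ))

  ⟨0,-⟩≈⨾ι₂ : {f : Hom C B} → ⟨ 0m {C} {A} , f ⟩ ≈ (f ⨾ ι₂)
  ⟨0,-⟩≈⨾ι₂ = ≈.sym (BP.⟨⟩-unique _ (≈.trans (pullʳ BP.ι₂π₁) zeroʳ)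
                                     (≈.trans (pullʳ BP.ι₂π₂) (identityʳ _)))

  ⟨id,0⟩≈ι₁ : ⟨ id , 0m ⟩ ≈ ι₁ {A} {B}
  ⟨id,0⟩≈ι₁ = ≈.trans ⟨-,0⟩≈⨾ι₁ (identityˡ _)

  ⟨0,id⟩≈ι₂ : ⟨ 0m , id ⟩ ≈ ι₂ {A} {B}
  ⟨0,id⟩≈ι₂ = ≈.trans ⟨0,-⟩≈⨾ι₂ (identityˡ _)

  ⊕₁-0 : {d : Hom X Y} → (d ⊕₁ 0m {Z} {W}) ≈ (π₁ ⨾ d ⨾ ι₁)
  ⊕₁-0 = ≈.trans (⟨⟩-cong ≈.refl zeroʳ) (≈.trans ⟨-,0⟩≈⨾ι₁ assoc′)

  ⊕₁-0-† : {d : Hom X Y} → ((d ⊕₁ 0m {Z} {W}) †) ≈ ((d †) ⊕₁ 0m)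
  ⊕₁-0-† {d = d} = begin
    (d ⊕₁ 0m) †           ≈⟨ †-cong ⊕₁-0 ⟩
    (π₁ ⨾ d ⨾ ι₁) †       ≈⟨ †⨾⨾ ⟩
    ι₁ † ⨾ d † ⨾ π₁ †     ≈⟨ ι₁-† ⟩⨾⟨ refl⟩⨾⟨ π₁†≈ι₁ ⟩
    π₁ ⨾ d † ⨾ ι₁         ≈⟨ ⊕₁-0 ⟨
    (d †) ⊕₁ 0m           ∎

  ⟨⟩⨾⊕₁ : {a : Hom C A} {b : Hom C B} {c : Hom A X} {d : Hom B Y} →
          (⟨ a , b ⟩ ⨾ (c ⊕₁ d)) ≈ ⟨ a ⨾ c , b ⨾ d ⟩
  ⟨⟩⨾⊕₁ = ≈.trans ⨾⟨⟩ (⟨⟩-cong (pullˡ (BP.⟨⟩-π₁ _ _)) (pullˡ (BP.⟨⟩-π₂ _ _)))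

  ⊕₁⨾∇ : {c : Hom A C} {d : Hom B C} → ((c ⊕₁ d) ⨾ [ id , id ]) ≈ [ c , d ]
  ⊕₁⨾∇ {c = c} {d} = BP.[]-unique _
    (≈.trans (pullˡ (≈.trans ⨾⟨⟩ (≈.trans (⟨⟩-cong (pullˡ BP.ι₁π₁) (pullˡ BP.ι₁π₂))
                                          (≈.trans (⟨⟩-cong (identityˡ _) zeroˡ) ⟨-,0⟩≈⨾ι₁))))
             (cancelʳ (BP.ι₁-[] _ _)))
    (≈.trans (pullˡ (≈.trans ⨾⟨⟩ (≈.trans (⟨⟩-cong (pullˡ BP.ι₂π₁) (pullˡ BP.ι₂π₂))
                                          (≈.trans (⟨⟩-cong zeroˡ (identityˡ _)) ⟨0,-⟩≈⨾ι₂))))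
             (cancelʳ (BP.ι₂-[] _ _)))

  ⟨⟩⨾[] : {a : Hom C A} {b : Hom C B} {c : Hom A D} {d : Hom B D} →
          (⟨ a , b ⟩ ⨾ [ c , d ]) ≈ ((a ⨾ c) + (b ⨾ d))
  ⟨⟩⨾[] = ≈.trans (refl⟩⨾⟨ ≈.sym ⊕₁⨾∇) (≈.trans sym-assoc (⟨⟩⨾⊕₁ ⟩⨾⟨refl))

  +-cong : {f f' g g' : Hom A B} → f ≈ f' → g ≈ g' → (f + g) ≈ (f' + g')
  +-cong p q = ⟨⟩-cong p q ⟩⨾⟨refl

  +-identityˡ : {f : Hom A B} → (0m + f) ≈ f
  +-identityˡ = ≈.trans (⟨0,-⟩≈⨾ι₂ ⟩⨾⟨refl) (cancelʳ (BP.ι₂-[] _ _))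

  +-identityʳ : {f : Hom A B} → (f + 0m) ≈ f
  +-identityʳ = ≈.trans (⟨-,0⟩≈⨾ι₁ ⟩⨾⟨refl) (cancelʳ (BP.ι₁-[] _ _))

  swap⨾∇ : (⟨ π₂ , π₁ ⟩ ⨾ [ id , id ]) ≈ [ id {A} , id ]
  swap⨾∇ = BP.[]-unique _
    (≈.trans (pullˡ (≈.trans ⨾⟨⟩ (≈.trans (⟨⟩-cong BP.ι₁π₂ BP.ι₁π₁) ⟨0,id⟩≈ι₂))) (BP.ι₂-[] _ _))
    (≈.trans (pullˡ (≈.trans ⨾⟨⟩ (≈.trans (⟨⟩-cong BP.ι₂π₂ BP.ι₂π₁) ⟨id,0⟩≈ι₁))) (BP.ι₁-[] _ _))

  +-comm : {f g : Hom A B} → (f + g) ≈ (g + f)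
  +-comm {f = f} {g} = begin
    ⟨ f , g ⟩ ⨾ [ id , id ]                    ≈⟨ refl⟩⨾⟨ swap⨾∇ ⟨
    ⟨ f , g ⟩ ⨾ ⟨ π₂ , π₁ ⟩ ⨾ [ id , id ]      ≈⟨ pullˡ (≈.trans ⨾⟨⟩ (⟨⟩-cong (BP.⟨⟩-π₂ _ _) (BP.⟨⟩-π₁ _ _))) ⟩
    ⟨ g , f ⟩ ⨾ [ id , id ]                    ∎

  ⨾-distribˡ-+ : {x : Hom C A} {f g : Hom A B} → (x ⨾ (f + g)) ≈ ((x ⨾ f) + (x ⨾ g))
  ⨾-distribˡ-+ = pullˡ ⨾⟨⟩

  ⨾-distribʳ-+ : {f g : Hom A B} {h : Hom B C} → ((f + g) ⨾ h) ≈ ((f ⨾ h) + (g ⨾ h))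
  ⨾-distribʳ-+ = ≈.trans (pullʳ (≈.trans []⨾ ([]-cong (identityˡ _) (identityˡ _)))) ⟨⟩⨾[]

  †-distrib-+ : {f g : Hom A B} → ((f + g) †) ≈ ((f †) + (g †))
  †-distrib-+ = ≈.trans †⨾ (≈.trans ([]-† ⟩⨾⟨ ⟨⟩-†)
                  (≈.trans ⟨⟩⨾[] (+-cong (≈.trans (†-id ⟩⨾⟨refl) (identityˡ _))
                                         (≈.trans (†-id ⟩⨾⟨refl) (identityˡ _)))))

  +-interchange : {a b c d : Hom A B} → ((a + b) + (c + d)) ≈ ((a + c) + (b + d))
  +-interchange {a = a} {b} {c} {d} = begin
    (a + b) + (c + d)                                          ≈⟨ ⟨⟩⨾[] ⟨
    ⟨ ⟨ a , b ⟩ , ⟨ c , d ⟩ ⟩ ⨾ [ [ id , id ] , [ id , id ] ]  ≈⟨ refl⟩⨾⟨ ∇⨾∇ ⟨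
    ⟨ ⟨ a , b ⟩ , ⟨ c , d ⟩ ⟩ ⨾ [ id , id ] ⨾ [ id , id ]      ≈⟨ pullˡ ⟨⟩+⟨⟩ ⟩
    ⟨ a + c , b + d ⟩ ⨾ [ id , id ]                            ∎
    where
    ∇⨾∇ : ([ id , id ] ⨾ [ id {A} , id ]) ≈ [ [ id , id ] , [ id , id ] ]
    ∇⨾∇ = ≈.trans []⨾ ([]-cong (identityˡ _) (identityˡ _))
    ⟨⟩+⟨⟩ : (⟨ a , b ⟩ + ⟨ c , d ⟩) ≈ ⟨ a + c , b + d ⟩
    ⟨⟩+⟨⟩ = BP.⟨⟩-unique _ (≈.trans ⨾-distribʳ-+ (+-cong (BP.⟨⟩-π₁ _ _) (BP.⟨⟩-π₁ _ _)))
                           (≈.trans ⨾-distribʳ-+ (+-cong (BP.⟨⟩-π₂ _ _) (BP.⟨⟩-π₂ _ _)))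

  +-assoc : {a b c : Hom A B} → ((a + b) + c) ≈ (a + (b + c))
  +-assoc {a = a} {b} {c} = begin
    (a + b) + c          ≈⟨ +-cong ≈.refl +-identityˡ ⟨
    (a + b) + (0m + c)   ≈⟨ +-interchange ⟩
    (a + 0m) + (b + c)   ≈⟨ +-cong +-identityʳ ≈.refl ⟩
    a + (b + c)          ∎

  IsKernel-resp-≈ : {k : Hom Z A} {g g' : Hom A B} → g ≈ g' → IsKernel bp k g → IsKernel bp k g'
  IsKernel-resp-≈ g≈g' (kg , factor) =
    ≈.trans (refl⟩⨾⟨ ≈.sym g≈g') kg , λ h hg' → factor h (≈.trans (refl⟩⨾⟨ g≈g') hg')

  IsKernel-unitary : {k : Hom Z A} {g : Hom A B} {u : Hom C A} →
                     IsUnitary 𝕏 u → IsKernel bp k g → IsKernel bp (k ⨾ u †) (u ⨾ g)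
  IsKernel-unitary {Z = Z} {C = C} {k = k} {g} {u} (uu† , u†u) (kg , factor) =
    ≈.trans assoc′ (≈.trans (refl⟩⨾⟨ cancelˡ u†u) kg) , factor′
    where
    factor′ : ∀ {D} (h : Hom D C) → (h ⨾ u ⨾ g) ≈ 0m →
              Σ[ m ∈ Hom D Z ] ((m ⨾ k ⨾ u †) ≈ h ×
                (∀ (m' : Hom D Z) → (m' ⨾ k ⨾ u †) ≈ h → m' ≈ m))
    factor′ h hug =
      let (m , mk , unique) = factor (h ⨾ u) (≈.trans assoc′ hug)
      in m , ≈.trans sym-assoc (≈.trans (mk ⟩⨾⟨refl) (cancelʳ uu†))
           , λ m' m'ku† → unique m' (≈.trans (≈.sym (cancelʳ u†u)) (≈.trans assoc′ m'ku† ⟩⨾⟨refl))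

  ι₂-isKernel : {g : Hom A C} {g' : Hom C A} → (g ⨾ g') ≈ id → IsKernel bp (ι₂ {A} {B}) (π₁ ⨾ g)
  ι₂-isKernel {A = A} {B = B} {g = g} {g'} gg' = ≈.trans (pullˡ BP.ι₂π₁) zeroˡ , factor
    where
    factor : ∀ {D} (h : Hom D (A ⊕ B)) → (h ⨾ π₁ ⨾ g) ≈ 0m →
             Σ[ m ∈ Hom D B ] ((m ⨾ ι₂) ≈ h × (∀ m' → (m' ⨾ ι₂) ≈ h → m' ≈ m))
    factor h hπ₁g = h ⨾ π₂ , ≈.sym (≈.trans (BP.⟨⟩-unique h hπ₁ ≈.refl) ⟨0,-⟩≈⨾ι₂)
                           , λ m' m'ι₂ → ≈.trans (≈.sym (cancelʳ BP.ι₂π₂)) (m'ι₂ ⟩⨾⟨refl)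
      where
      hπ₁ : (h ⨾ π₁) ≈ 0m
      hπ₁ = begin
        h ⨾ π₁              ≈⟨ cancelʳ gg' ⟨
        ((h ⨾ π₁) ⨾ g) ⨾ g' ≈⟨ ≈.trans assoc′ hπ₁g ⟩⨾⟨refl ⟩
        0m ⨾ g'             ≈⟨ zeroˡ ⟩
        0m                  ∎

  ⨾-split-zero : {x : Hom Z A} {r : Hom A X} →
                 (x ⨾ r ⨾ r †) ≈ 0m → (r † ⨾ r) ≈ id → (x ⨾ r) ≈ 0m
  ⨾-split-zero {x = x} {r} xrr† r†r = begin
    x ⨾ r               ≈⟨ refl⟩⨾⟨ cancelʳ r†r ⟨
    x ⨾ (r ⨾ r †) ⨾ r   ≈⟨ pullˡ xrr† ⟩
    0m ⨾ r              ≈⟨ zeroˡ ⟩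
    0m                  ∎

  -- A self-adjoint p killed by g factors as m k, and fixing k forces m = k†.
  kernel-projection : {k : Hom Z A} {g : Hom A B} {p : Hom A A} →
                      IsKernel bp k g → IsIsometry 𝕏 k →
                      SelfAdjoint p → (p ⨾ g) ≈ 0m → (k ⨾ p) ≈ k → p ≈ (k † ⨾ k)
  kernel-projection {k = k} {g} {p} (_ , factor) kk† p† pg kp =
    let (m , mk , _) = factor p pg
        p≈k†m† : p ≈ (k † ⨾ m †)
        p≈k†m† = ≈.trans (≈.sym p†) (≈.trans (†-cong (≈.sym mk)) †⨾)
        k≈m† : k ≈ (m †)
        k≈m† = ≈.trans (≈.sym kp) (≈.trans (refl⟩⨾⟨ p≈k†m†) (cancelˡ kk†))
    in ≈.trans p≈k†m† (refl⟩⨾⟨ ≈.sym k≈m†)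

  ⟨⟩-unitary : {a : Hom A X} {b : Hom A Z} →
               (a † ⨾ a) ≈ id → (b † ⨾ b) ≈ id → (b † ⨾ a) ≈ 0m →
               ((a ⨾ a †) + (b ⨾ b †)) ≈ id → IsUnitary 𝕏 ⟨ a , b ⟩
  ⟨⟩-unitary {a = a} {b} a†a b†b b†a aa†+bb† =
    ≈.trans (refl⟩⨾⟨ ⟨⟩-†) (≈.trans ⟨⟩⨾[] aa†+bb†) , (begin
      ⟨ a , b ⟩ † ⨾ ⟨ a , b ⟩                   ≈⟨ ⟨⟩-† ⟩⨾⟨refl ⟩
      [ a † , b † ] ⨾ ⟨ a , b ⟩                 ≈⟨ []⨾ ⟩
      [ a † ⨾ ⟨ a , b ⟩ , b † ⨾ ⟨ a , b ⟩ ]     ≈⟨ []-cong (≈.trans ⨾⟨⟩ (⟨⟩-cong a†a a†b))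
                                                           (≈.trans ⨾⟨⟩ (⟨⟩-cong b†a b†b)) ⟩
      [ ⟨ id , 0m ⟩ , ⟨ 0m , id ⟩ ]             ≈⟨ []-cong ⟨id,0⟩≈ι₁ ⟨0,id⟩≈ι₂ ⟩
      [ ι₁ , ι₂ ]                               ≈⟨ BP.[]-unique _ (identityʳ _) (identityʳ _) ⟨
      id                                        ∎)
    where
    a†b : (a † ⨾ b) ≈ 0m
    a†b = ≈.trans (refl⟩⨾⟨ ≈.sym ††) (≈.trans (≈.sym †⨾) (≈.trans (†-cong b†a) 0m-†))

  gsvd-form : {u : Hom A (X ⊕ Z)} {d : Hom X Y} {v : Hom (Y ⊕ W) B} →
              (u ⨾ (d ⊕₁ 0m) ⨾ v) ≈ (u ⨾ π₁ ⨾ d ⨾ ι₁ ⨾ v)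
  gsvd-form = refl⟩⨾⟨ ≈.trans (⊕₁-0 ⟩⨾⟨refl) assoc²

  isMoorePenroseSplit-factor : {f : Hom A B} {a : Hom A X} {d : Hom X Y} {b : Hom Y B} →
                               (a † ⨾ a) ≈ id → (b ⨾ b †) ≈ id → IsIso 𝕏 d →
                               f ≈ (a ⨾ d ⨾ b) → IsMoorePenroseSplit bp f
  isMoorePenroseSplit-factor {f = f} {a} {d} {b} a†a bb† (d⁻¹ , dd⁻¹ , d⁻¹d) f≈adb =
    f° , (ff°f , f°ff° , selfAdjoint-resp-≈ ff°≈aa† ⨾†-selfAdjoint
                       , selfAdjoint-resp-≈ f°f≈b†b†† ⨾†-selfAdjoint)
       , (_ , a , ff°≈aa† , a†a)
       , (_ , b † , f°f≈b†b†† , ≈.trans (†† ⟩⨾⟨refl) bb†)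
    where
    f° = b † ⨾ d⁻¹ ⨾ a †
    ff°≈aa† : (f ⨾ f°) ≈ (a ⨾ a †)
    ff°≈aa† = ≈.trans (f≈adb ⟩⨾⟨refl)
                (≈.trans assoc² (refl⟩⨾⟨ ≈.trans (refl⟩⨾⟨ cancelˡ bb†) (cancelˡ dd⁻¹)))
    f°f≈b†b : (f° ⨾ f) ≈ (b † ⨾ b)
    f°f≈b†b = ≈.trans (refl⟩⨾⟨ f≈adb)
                (≈.trans assoc² (refl⟩⨾⟨ ≈.trans (refl⟩⨾⟨ cancelˡ a†a) (cancelˡ d⁻¹d)))
    f°f≈b†b†† : (f° ⨾ f) ≈ (b † ⨾ b † †)
    f°f≈b†b†† = ≈.trans f°f≈b†b (refl⟩⨾⟨ ≈.sym ††)
    ff°f : (f ⨾ f° ⨾ f) ≈ f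
    ff°f = ≈.trans sym-assoc (≈.trans (ff°≈aa† ⟩⨾⟨ f≈adb)
             (≈.trans assoc′ (≈.trans (refl⟩⨾⟨ cancelˡ a†a) (≈.sym f≈adb))))
    f°ff° : (f° ⨾ f ⨾ f°) ≈ f°
    f°ff° = ≈.trans (refl⟩⨾⟨ ff°≈aa†) (≈.trans assoc² (refl⟩⨾⟨ refl⟩⨾⟨ cancelˡ a†a))

  gsvd⇒isMoorePenroseSplit : {f : Hom A B} → HasGSVD bp f → IsMoorePenroseSplit bp f
  gsvd⇒isMoorePenroseSplit (_ , _ , _ , _ , u , d , v , (_ , u†u) , d-iso , (vv† , _) , f≈) =
    isMoorePenroseSplit-factor
      (≈.trans (≈.trans †⨾ (π₁†≈ι₁ ⟩⨾⟨refl) ⟩⨾⟨refl)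
        (≈.trans assoc′ (≈.trans (refl⟩⨾⟨ cancelˡ u†u) BP.ι₁π₁)))
      (isometry-⨾ (≈.trans (refl⟩⨾⟨ ι₁-†) BP.ι₁π₁) vv†)
      d-iso
      (≈.trans f≈ (≈.trans gsvd-form sym-assoc))

  gsvd⇒hasDaggerKernel : {f : Hom A B} → HasGSVD bp f → HasDaggerKernel bp f
  gsvd⇒hasDaggerKernel (_ , Z , _ , _ , u , d , v , uU , (d⁻¹ , dd⁻¹ , _) , (vv† , _) , f≈) =
    Z , ι₂ ⨾ u † , IsKernel-resp-≈ (≈.sym (≈.trans f≈ gsvd-form))
                                   (IsKernel-unitary uU (ι₂-isKernel retraction))
                 , isometry-⨾ ι₂-isometry (proj₁ (unitary-† uU))
    where
    retraction : ((d ⨾ ι₁ ⨾ v) ⨾ (v † ⨾ π₁ ⨾ d⁻¹)) ≈ id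
    retraction = ≈.trans assoc² (≈.trans (refl⟩⨾⟨ refl⟩⨾⟨ cancelˡ vv†)
                                 (≈.trans (refl⟩⨾⟨ cancelˡ BP.ι₁π₁) dd⁻¹))

  gsvd-† : {f : Hom A B} → HasGSVD bp f → HasGSVD bp (f †)
  gsvd-† {f = f} (X , Z , Y , W , u , d , v , uU , d-iso , vU , f≈) =
    Y , W , X , Z , v † , d † , u † , unitary-† vU , iso-† d-iso , unitary-† uU , (begin
      f †                           ≈⟨ †-cong f≈ ⟩
      (u ⨾ (d ⊕₁ 0m) ⨾ v) †         ≈⟨ †⨾⨾ ⟩
      v † ⨾ (d ⊕₁ 0m) † ⨾ u †       ≈⟨ refl⟩⨾⟨ ⊕₁-0-† ⟩⨾⟨refl ⟩
      v † ⨾ ((d †) ⊕₁ 0m) ⨾ u †     ∎)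

  moorePenrose-† : {f : Hom A B} {f° : Hom B A} →
                   IsMoorePenroseInverse bp f f° → IsMoorePenroseInverse bp (f †) (f° †)
  moorePenrose-† (ff°f , f°ff° , ff°† , f°f†) =
    ≈.trans (≈.sym †⨾⨾) (†-cong ff°f) , ≈.trans (≈.sym †⨾⨾) (†-cong f°ff°)
    , selfAdjoint-resp-≈ (≈.sym †⨾) (selfAdjoint-† f°f†)
    , selfAdjoint-resp-≈ (≈.sym †⨾) (selfAdjoint-† ff°†)

  splittings-iso : {f : Hom A B} {f° : Hom B A} {r : Hom A X} {s : Hom B Y} →
                   IsMoorePenroseInverse bp f f° →
                   (f ⨾ f°) ≈ (r ⨾ r †) → (r † ⨾ r) ≈ id →
                   (f° ⨾ f) ≈ (s ⨾ s †) → (s † ⨾ s) ≈ id → IsIso 𝕏 (r † ⨾ f ⨾ s)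
  splittings-iso {f = f} {f°} {r} {s} (ff°f , f°ff° , _ , _) ff°≈rr† r†r f°f≈ss† s†s =
    s † ⨾ f° ⨾ r , (begin
      (r † ⨾ f ⨾ s) ⨾ (s † ⨾ f° ⨾ r)   ≈⟨ assoc² ⟩
      r † ⨾ f ⨾ s ⨾ (s † ⨾ f° ⨾ r)     ≈⟨ refl⟩⨾⟨ ≈.trans (refl⟩⨾⟨ sym-assoc) (pullˡ fss†) ⟩
      r † ⨾ f ⨾ f° ⨾ r                 ≈⟨ refl⟩⨾⟨ pullˡ ff°≈rr† ⟩
      r † ⨾ (r ⨾ r †) ⨾ r              ≈⟨ refl⟩⨾⟨ cancelʳ r†r ⟩
      r † ⨾ r                          ≈⟨ r†r ⟩
      id                               ∎) , (begin
      (s † ⨾ f° ⨾ r) ⨾ (r † ⨾ f ⨾ s)   ≈⟨ assoc² ⟩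
      s † ⨾ f° ⨾ r ⨾ (r † ⨾ f ⨾ s)     ≈⟨ refl⟩⨾⟨ refl⟩⨾⟨ pullˡ (≈.sym ff°≈rr†) ⟩
      s † ⨾ f° ⨾ (f ⨾ f°) ⨾ (f ⨾ s)    ≈⟨ refl⟩⨾⟨ ≈.trans sym-assoc (f°ff° ⟩⨾⟨refl) ⟩
      s † ⨾ f° ⨾ f ⨾ s                 ≈⟨ refl⟩⨾⟨ pullˡ f°f≈ss† ⟩
      s † ⨾ (s ⨾ s †) ⨾ s              ≈⟨ refl⟩⨾⟨ cancelʳ s†s ⟩
      s † ⨾ s                          ≈⟨ s†s ⟩
      id                               ∎)
    where
    fss† : (f ⨾ s ⨾ s †) ≈ f
    fss† = ≈.trans (refl⟩⨾⟨ ≈.sym f°f≈ss†) ff°f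

  -- The second components x, y are annihilated by d ⊕₁ 0m.
  splittings-factorization : {f : Hom A B} {f° : Hom B A} {r : Hom A X} {s : Hom B Y}
                             {x : Hom A Z} {y : Hom B W} →
                             IsMoorePenroseInverse bp f f° →
                             (f ⨾ f°) ≈ (r ⨾ r †) → (f° ⨾ f) ≈ (s ⨾ s †) →
                             f ≈ (⟨ r , x ⟩ ⨾ ((r † ⨾ f ⨾ s) ⊕₁ 0m) ⨾ ⟨ s , y ⟩ †)
  splittings-factorization {f = f} {f°} {r} {s} {x} {y} (ff°f , _ , _ , _) ff°≈rr† f°f≈ss† =
    ≈.sym (begin
      ⟨ r , x ⟩ ⨾ ((r † ⨾ f ⨾ s) ⊕₁ 0m) ⨾ ⟨ s , y ⟩ †   ≈⟨ gsvd-form ⟩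
      ⟨ r , x ⟩ ⨾ π₁ ⨾ (r † ⨾ f ⨾ s) ⨾ ι₁ ⨾ ⟨ s , y ⟩ † ≈⟨ pullˡ (BP.⟨⟩-π₁ _ _) ⟩
      r ⨾ (r † ⨾ f ⨾ s) ⨾ ι₁ ⨾ ⟨ s , y ⟩ †              ≈⟨ refl⟩⨾⟨ refl⟩⨾⟨ ι₁⨾⟨⟩† ⟩
      r ⨾ (r † ⨾ f ⨾ s) ⨾ s †                           ≈⟨ refl⟩⨾⟨ ≈.trans assoc² (refl⟩⨾⟨ fss†) ⟩
      r ⨾ r † ⨾ f                                       ≈⟨ pullˡ (≈.sym ff°≈rr†) ⟩
      (f ⨾ f°) ⨾ f                                      ≈⟨ ≈.trans assoc′ ff°f ⟩
      f                                                 ∎)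
    where
    fss† : (f ⨾ s ⨾ s †) ≈ f
    fss† = ≈.trans (refl⟩⨾⟨ ≈.sym f°f≈ss†) ff°f
    ι₁⨾⟨⟩† : (ι₁ ⨾ ⟨ s , y ⟩ †) ≈ (s †)
    ι₁⨾⟨⟩† = ≈.trans (refl⟩⨾⟨ ⟨⟩-†) (BP.ι₁-[] _ _)

module NegativesProperties {o ℓ e : Level} {𝕏 : DaggerCategory o ℓ e}
                           {bp : DaggerBiproducts 𝕏} (neg : HasNegatives bp) where
  open DaggerCategory 𝕏
  open DaggerProperties 𝕏
  open DaggerBiproducts bp
  open BiproductProperties bp
  open HasNegatives neg

  private
    variable
      A B X Y Z : Obj

  +-inverseʳ-unique : {f n n' : Hom A B} → (f + n) ≈ 0m → (f + n') ≈ 0m → n ≈ n'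
  +-inverseʳ-unique {f = f} {n} {n'} f+n f+n' = begin
    n               ≈⟨ +-identityʳ ⟨
    n + 0m          ≈⟨ +-cong ≈.refl f+n' ⟨
    n + (f + n')    ≈⟨ +-assoc ⟨
    (n + f) + n'    ≈⟨ +-cong (≈.trans +-comm f+n) ≈.refl ⟩
    0m + n'         ≈⟨ +-identityˡ ⟩
    n'              ∎

  kernel-complement : {k : Hom Z A} {g : Hom A B} {ε : Hom A A} →
                      IsKernel bp k g → IsIsometry 𝕏 k →
                      SelfAdjoint ε → (ε ⨾ g) ≈ g → (k ⨾ ε) ≈ 0m → (ε + (k † ⨾ k)) ≈ id
  kernel-complement {k = k} {g} {ε} k-kernel kk† ε† εg kε = begin
    ε + k † ⨾ k          ≈⟨ +-cong ≈.refl p≈k†k ⟨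
    ε + (id + -ε)        ≈⟨ +-cong ≈.refl +-comm ⟩
    ε + (-ε + id)        ≈⟨ +-assoc ⟨
    (ε + -ε) + id        ≈⟨ +-cong ε+-ε ≈.refl ⟩
    0m + id              ≈⟨ +-identityˡ ⟩
    id                   ∎
    where
    -ε = proj₁ (negatives ε)
    ε+-ε : (ε + -ε) ≈ 0m
    ε+-ε = proj₂ (negatives ε)
    p = id + -ε
    pg : (p ⨾ g) ≈ 0m
    pg = ≈.trans ⨾-distribʳ-+ (≈.trans (+-cong (≈.trans (identityˡ _) (≈.sym εg)) ≈.refl)
           (≈.trans (≈.sym ⨾-distribʳ-+) (≈.trans (ε+-ε ⟩⨾⟨refl) zeroˡ)))
    k-ε : (k ⨾ -ε) ≈ 0m
    k-ε = ≈.trans (≈.sym +-identityˡ) (≈.trans (+-cong (≈.sym kε) ≈.refl)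
            (≈.trans (≈.sym ⨾-distribˡ-+) (≈.trans (refl⟩⨾⟨ ε+-ε) zeroʳ)))
    kp : (k ⨾ p) ≈ k
    kp = ≈.trans ⨾-distribˡ-+ (≈.trans (+-cong (identityʳ _) k-ε) +-identityʳ)
    -ε† : SelfAdjoint -ε
    -ε† = ≈.sym (+-inverseʳ-unique ε+-ε
            (≈.trans (+-cong (≈.sym ε†) ≈.refl) (≈.trans (≈.sym †-distrib-+)
              (≈.trans (†-cong ε+-ε) 0m-†))))
    p≈k†k : p ≈ (k † ⨾ k)
    p≈k†k = kernel-projection k-kernel kk† (≈.trans †-distrib-+ (+-cong †-id -ε†)) pg kp

  splitting-kernel-unitary : {f : Hom A B} {f° : Hom B A} {r : Hom A X} {k : Hom Z A} →
                             IsMoorePenroseInverse bp f f° →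
                             (f ⨾ f°) ≈ (r ⨾ r †) → (r † ⨾ r) ≈ id →
                             IsKernel bp k f → IsIsometry 𝕏 k → IsUnitary 𝕏 ⟨ r , k † ⟩
  splitting-kernel-unitary {f = f} {f°} {r} {k} (ff°f , _ , ff°† , _) ff°≈rr† r†r k-kernel kk† =
    ⟨⟩-unitary r†r (≈.trans (†† ⟩⨾⟨refl) kk†)
      (≈.trans (†† ⟩⨾⟨refl) (⨾-split-zero (≈.trans (refl⟩⨾⟨ ≈.sym ff°≈rr†) kff°) r†r))
      (≈.trans (+-cong (≈.sym ff°≈rr†) (refl⟩⨾⟨ ††))
        (kernel-complement k-kernel kk† ff°† (≈.trans assoc′ ff°f) kff°))
    where
    kff° : (k ⨾ f ⨾ f°) ≈ 0m
    kff° = ≈.trans (pullˡ (proj₁ k-kernel)) zeroˡ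

  moorePenroseSplit×kernels⇒gsvd : {f : Hom A B} →
                                   IsMoorePenroseSplit bp f × HasDaggerKernel bp f ×
                                   HasDaggerKernel bp (f †) → HasGSVD bp f
  moorePenroseSplit×kernels⇒gsvd {f = f}
    ((f° , mp@(_ , _ , _ , f°f†) , (X , r , ff°≈rr† , r†r) , (Y , s , f°f≈ss† , s†s)) ,
     (Z , k , k-kernel , kk†) , (W , k' , k'-kernel , k'k'†)) =
    X , Z , Y , W , ⟨ r , k † ⟩ , r † ⨾ f ⨾ s , ⟨ s , k' † ⟩ † ,
    splitting-kernel-unitary mp ff°≈rr† r†r k-kernel kk† ,
    splittings-iso mp ff°≈rr† r†r f°f≈ss† s†s ,
    unitary-† (splitting-kernel-unitary (moorePenrose-† mp) f†f°†≈ss† s†s k'-kernel k'k'†) ,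
    splittings-factorization mp ff°≈rr† f°f≈ss†
    where
    f†f°†≈ss† : (f † ⨾ f° †) ≈ (s ⨾ s †)
    f†f°†≈ss† = ≈.trans (≈.sym †⨾) (≈.trans f°f† f°f≈ss†)

mainTheorem15 : ∀ {o ℓ e : Level} (𝕏 : DaggerCategory o ℓ e)
                  (bp : DaggerBiproducts 𝕏) (neg : HasNegatives bp)
                  {A B : DaggerCategory.Obj 𝕏}
                  (f : DaggerCategory.Hom 𝕏 A B) →
                  HasGSVD bp f ⇔
                    (IsMoorePenroseSplit bp f × HasDaggerKernel bp f ×
                     HasDaggerKernel bp (DaggerCategory._† 𝕏 f))
mainTheorem15 𝕏 bp neg f =
  mk⇔ (λ gsvd → gsvd⇒isMoorePenroseSplit gsvd , gsvd⇒hasDaggerKernel gsvd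
                , gsvd⇒hasDaggerKernel (gsvd-† gsvd))
      moorePenroseSplit×kernels⇒gsvd
  where
  open BiproductProperties bp
  open NegativesProperties neg
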